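{- Let $b,c$ be rational numbers with $\Delta\,(bc-1-b)(bc-c-2b)\neq 0$ (where $\Delta$ is as in the context), and suppose $2bc^2-4bc+2b-c^2=0$. Then both cubic polynomials $P(x)$ and $Q(d)$ (defined in the context) are reducible over $\mathbb{Q}$; in this case $P$ has the root $x=0$ and $Q$ has the root $d=1$.
   Context: Let $b,c$ be rational numbers. Put $\Delta=b^2c^4-6b^2c^3+13b^2c^2-12b^2c+4b^2+c^2$ and, when $\Delta\,(bc-1-b)(bc-c-2b)\neq 0$, define (with $D=b^2c^2+2b^2-3b^2c+c-bc^2+2b$): $E_{01}=-\frac{b(c^2+2-2c)}{D}$, $E_{10}=-\frac{b^2c^2+2b^2-3b^2c-c}{D}$; $E_{20}=\frac{b}{2}(bc^2-2c-2b)(2bc^2-c^2-6bc+2+4b)(bc-1-b)^{ -2}(bc-c-2b)^{ -2}$; $E_{02}=\frac12(28b^2c^2-16b^2c-2c^2-4b^2-b^2c^4+4b^3c^4-12b^3c^3+4bc^3+24b^3c-8bc-2b^4c^4+12b^4c^3-26b^4c^2-8b^2c^3+24b^4c-16b^3-8b^4)(bc-1-b)^{ -2}(bc-c-2b)^{ -2}$; $E_{03}=\frac{b}{2}(b^2c^4-5b^2c^3+10b^2c^2-10b^2c+4b^2+2bc+2c^2-bc^3)(2b^2c^4-12b^2c^3+26b^2c^2-24b^2c+8b^2-c^4b+3bc^3-6bc+4b+c^3-2c^2+2c)\,\Delta^{ -1}(bc-1-b)^{ -2}(bc-c-2b)^{ -2}$; $E_{30}=c\,b^2(1-c)(c-2)(bc^2-4bc+2+4b)(2bc^2-c^2-4bc+2b)\,\Delta^{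 -1}(bc-1-b)^{ -2}(bc-c-2b)^{ -2}$. Define $P(x)=x^3-E_{10}x^2+E_{20}x-E_{30}$ and $Q(d)=d^3-E_{01}d^2+E_{02}d-E_{03}$. -}

module Defs where

open import Data.Nat using (ℕ; zero; suc)
open import Data.Integer using (+_)
open import Data.Rational using (ℚ; _+_; _*_; _-_; -_; 0ℚ; 1ℚ; _/_; _÷_; ≢-nonZero)
open import Data.Rational.Properties using (_≟_)
open import Data.Product using (Σ; _×_)
open import Relation.Binary.PropositionalEquality using (_≡_; _≢_)
open import Relation.Nullary using (yes; no)

k : ℕ → ℚ
k n = + n / 1

_^_ : ℚ → ℕ → ℚ
x ^ zero = 1ℚ
x ^ suc n = x * (x ^ n)

infixr 8 _^_

-- total division (value 0 when the denominator is 0); only ever used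
-- under hypotheses guaranteeing the denominator is nonzero
_⊘_ : ℚ → ℚ → ℚ
p ⊘ q with q ≟ 0ℚ
... | yes _ = 0ℚ
... | no q≢0 = _÷_ p q {{≢-nonZero q≢0}}

infixl 7 _⊘_

module _ (b c : ℚ) where
  Δ : ℚ
  Δ = k 1 * b ^ 2 * c ^ 4 - k 6 * b ^ 2 * c ^ 3 + k 13 * b ^ 2 * c ^ 2
      - k 12 * b ^ 2 * c + k 4 * b ^ 2 + c ^ 2

  F₁ : ℚ
  F₁ = b * c - k 1 - b

  F₂ : ℚ
  F₂ = b * c - c - k 2 * b

  D : ℚ
  D = b ^ 2 * c ^ 2 + k 2 * b ^ 2 - k 3 * b ^ 2 * c + c - b * c ^ 2 + k 2 * b

  F² : ℚ
  F² = F₁ ^ 2 * F₂ ^ 2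

  half : ℚ
  half = (+ 1) / 2

  E01 : ℚ
  E01 = - (b * (c ^ 2 + k 2 - k 2 * c)) ⊘ D

  E10 : ℚ
  E10 = - (b ^ 2 * c ^ 2 + k 2 * b ^ 2 - k 3 * b ^ 2 * c - c) ⊘ D

  E20 : ℚ
  E20 = (half * b * (b * c ^ 2 - k 2 * c - k 2 * b)
         * (k 2 * b * c ^ 2 - c ^ 2 - k 6 * b * c + k 2 + k 4 * b)) ⊘ F²

  E02 : ℚ
  E02 = (half * (k 28 * b ^ 2 * c ^ 2 - k 16 * b ^ 2 * c - k 2 * c ^ 2 - k 4 * b ^ 2
         - b ^ 2 * c ^ 4 + k 4 * b ^ 3 * c ^ 4 - k 12 * b ^ 3 * c ^ 3 + k 4 * b * c ^ 3
         + k 24 * b ^ 3 * c - k 8 * b * c - k 2 * b ^ 4 * c ^ 4 + k 12 * b ^ 4 * c ^ 3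
         - k 26 * b ^ 4 * c ^ 2 - k 8 * b ^ 2 * c ^ 3 + k 24 * b ^ 4 * c - k 16 * b ^ 3
         - k 8 * b ^ 4)) ⊘ F²

  E03 : ℚ
  E03 = (half * b
         * (b ^ 2 * c ^ 4 - k 5 * b ^ 2 * c ^ 3 + k 10 * b ^ 2 * c ^ 2 - k 10 * b ^ 2 * c
            + k 4 * b ^ 2 + k 2 * b * c + k 2 * c ^ 2 - b * c ^ 3)
         * (k 2 * b ^ 2 * c ^ 4 - k 12 * b ^ 2 * c ^ 3 + k 26 * b ^ 2 * c ^ 2
            - k 24 * b ^ 2 * c + k 8 * b ^ 2 - c ^ 4 * b + k 3 * b * c ^ 3 - k 6 * b * c
            + k 4 * b + c ^ 3 - k 2 * c ^ 2 + k 2 * c)) ⊘ (Δ * F²)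

  E30 : ℚ
  E30 = (c * b ^ 2 * (k 1 - c) * (c - k 2) * (b * c ^ 2 - k 4 * b * c + k 2 + k 4 * b)
         * (k 2 * b * c ^ 2 - c ^ 2 - k 4 * b * c + k 2 * b)) ⊘ (Δ * F²)

record Cubic : Set where
  constructor cubic
  field
    a₂ a₁ a₀ : ℚ

eval : Cubic → ℚ → ℚ
eval (cubic a₂ a₁ a₀) x = x ^ 3 + a₂ * x ^ 2 + a₁ * x + a₀

-- Reducible over ℚ: it is a product of two non-constant polynomials with
-- rational coefficients; for a cubic the degrees are necessarily 1 and 2:
--   X^3 + a₂X^2 + a₁X + a₀ = (p₁X + p₀)(q₂X^2 + q₁X + q₀),  p₁ ≠ 0, q₂ ≠ 0
-- (equality of polynomials = equality of all coefficients).
Reducible : Cubic → Set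
Reducible (cubic a₂ a₁ a₀) =
  Σ ℚ λ p₁ → Σ ℚ λ p₀ → Σ ℚ λ q₂ → Σ ℚ λ q₁ → Σ ℚ λ q₀ →
    p₁ ≢ 0ℚ × q₂ ≢ 0ℚ ×
    p₁ * q₂ ≡ 1ℚ ×
    p₁ * q₁ + p₀ * q₂ ≡ a₂ ×
    p₁ * q₀ + p₀ * q₁ ≡ a₁ ×
    p₀ * q₀ ≡ a₀

P : ℚ → ℚ → Cubic
P b c = cubic (- E10 b c) (E20 b c) (- E30 b c)

Q : ℚ → ℚ → Cubic
Q b c = cubic (- E01 b c) (E02 b c) (- E03 b c)

{-# OPTIONS --safe #-}
module Submission where

open import Data.Fin using (zero; suc)
open import Data.Integer using (+_)
open import Data.Nat using (ℕ)
open import Data.Product using (_×_; _,_)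
open import Data.Rational using (ℚ; _+_; _*_; _-_; -_; 1/_; _/_; 0ℚ; 1ℚ; ≢-nonZero)
open import Data.Rational.Properties
  using (_≟_; 1≢0; *-assoc; *-comm; *-identityˡ; *-identityʳ; *-inverseˡ; *-zeroˡ; *-zeroʳ)
open import Data.Rational.Solver using (module +-*-Solver)
open import Data.Vec using (_∷_; [])
open import Relation.Binary.PropositionalEquality
  using (_≡_; _≢_; refl; sym; trans; cong; module ≡-Reasoning)
open import Relation.Nullary using (yes; no; contradiction)

open import Defs

open +-*-Solver

-- On the curve  h := 2b(c-1)^2 - c^2 = 0  the factor 2bc^2 - c^2 - 4bc + 2b of the numerator
-- of E30 is h itself, so P(0) = -E30 = 0.  Since D = F₁F₂, clearing the denominators of Q(1)
-- gives the identity  D Δ F² Q(1) = D (b (c-2) h)^2,  so Q(1) = 0 as well.  A rational root r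
-- of a monic cubic splits off the factor X - r.

x*y≡0⇒y≡0 : ∀ {x y} → x ≢ 0ℚ → x * y ≡ 0ℚ → y ≡ 0ℚ
x*y≡0⇒y≡0 {x} {y} x≢0 xy≡0 = begin
  y                ≡⟨ sym (*-identityˡ y) ⟩
  1ℚ * y           ≡⟨ cong (_* y) (sym (*-inverseˡ x)) ⟩
  1/ x * x * y     ≡⟨ *-assoc (1/ x) x y ⟩
  1/ x * (x * y)   ≡⟨ cong (1/ x *_) xy≡0 ⟩
  1/ x * 0ℚ        ≡⟨ *-zeroʳ (1/ x) ⟩
  0ℚ               ∎
  where
  open ≡-Reasoning
  instance _ = ≢-nonZero x≢0

x*y≡0⇒x≡0 : ∀ {x y} → y ≢ 0ℚ → x * y ≡ 0ℚ → x ≡ 0ℚ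
x*y≡0⇒x≡0 {x} {y} y≢0 xy≡0 = x*y≡0⇒y≡0 y≢0 (trans (*-comm y x) xy≡0)

x*y≢0 : ∀ {x y} → x ≢ 0ℚ → y ≢ 0ℚ → x * y ≢ 0ℚ
x*y≢0 x≢0 y≢0 xy≡0 = y≢0 (x*y≡0⇒y≡0 x≢0 xy≡0)

x*y≢0⇒x≢0 : ∀ x y → x * y ≢ 0ℚ → x ≢ 0ℚ
x*y≢0⇒x≢0 _ y xy≢0 refl = xy≢0 (*-zeroˡ y)

x*y≢0⇒y≢0 : ∀ x y → x * y ≢ 0ℚ → y ≢ 0ℚ
x*y≢0⇒y≢0 x _ xy≢0 refl = xy≢0 (*-zeroʳ x)

x⊘y*y≡x : ∀ x {y} → y ≢ 0ℚ → x ⊘ y * y ≡ x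
x⊘y*y≡x x {y} y≢0 with y ≟ 0ℚ
... | yes y≡0 = contradiction y≡0 y≢0
... | no y≢0′ = begin
  x * 1/ y * y     ≡⟨ *-assoc x (1/ y) y ⟩
  x * (1/ y * y)   ≡⟨ cong (x *_) (*-inverseˡ y) ⟩
  x * 1ℚ           ≡⟨ *-identityʳ x ⟩
  x                ∎
  where
  open ≡-Reasoning
  instance _ = ≢-nonZero y≢0′

x*z⊘y≡0 : ∀ x y {z} → z ≡ 0ℚ → (x * z) ⊘ y ≡ 0ℚ
x*z⊘y≡0 x y refl with y ≟ 0ℚ
... | yes _ = refl
... | no y≢0 rewrite *-zeroʳ x = *-zeroˡ (1/ y)
  where instance _ = ≢-nonZero y≢0

root⇒reducible : ∀ f r → eval f r ≡ 0ℚ → Reducible f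
root⇒reducible (cubic a₂ a₁ a₀) r f[r]≡0 =
  1ℚ , - r , 1ℚ , a₂ + r , a₁ + r * a₂ + r * r ,
  1≢0 , 1≢0 , refl , linear a₂ r , constant a₂ a₁ r , trans (product a₂ a₁ a₀ r) a₀-0≡a₀
  where
  open ≡-Reasoning
  linear : ∀ a₂ r → 1ℚ * (a₂ + r) + - r * 1ℚ ≡ a₂
  linear = solve 2 (λ a₂ r → con 1ℚ :* (a₂ :+ r) :+ :- r :* con 1ℚ := a₂) refl
  constant : ∀ a₂ a₁ r → 1ℚ * (a₁ + r * a₂ + r * r) + - r * (a₂ + r) ≡ a₁
  constant = solve 3 (λ a₂ a₁ r → con 1ℚ :* (a₁ :+ r :* a₂ :+ r :* r) :+ :- r :* (a₂ :+ r) := a₁) refl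
  product : ∀ a₂ a₁ a₀ r → - r * (a₁ + r * a₂ + r * r) ≡ a₀ - eval (cubic a₂ a₁ a₀) r
  product = solve 4 (λ a₂ a₁ a₀ r → :- r :* (a₁ :+ r :* a₂ :+ r :* r)
                       := a₀ :- (r :^ 3 :+ a₂ :* r :^ 2 :+ a₁ :* r :+ a₀)) refl
  a₀-0≡a₀ : a₀ - eval (cubic a₂ a₁ a₀) r ≡ a₀
  a₀-0≡a₀ = begin
    a₀ - eval (cubic a₂ a₁ a₀) r ≡⟨ cong (λ t → a₀ - t) f[r]≡0 ⟩
    a₀ - 0ℚ                      ≡⟨ solve 1 (λ a → a :- con 0ℚ := a) refl a₀ ⟩
    a₀                           ∎

eval-0 : ∀ a₂ a₁ a₀ → eval (cubic a₂ a₁ a₀) 0ℚ ≡ a₀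
eval-0 = solve 3 (λ a₂ a₁ a₀ → con 0ℚ :^ 3 :+ a₂ :* con 0ℚ :^ 2 :+ a₁ :* con 0ℚ :+ a₀ := a₀) refl

eval-1-cleared : ∀ e₁ e₂ e₃ d δ f {n₁ n₂ n₃} →
  e₁ * d ≡ n₁ → e₂ * f ≡ n₂ → e₃ * (δ * f) ≡ n₃ →
  eval (cubic (- e₁) e₂ (- e₃)) 1ℚ * (d * (δ * f))
    ≡ d * (δ * f) - n₁ * (δ * f) + n₂ * (d * δ) - n₃ * d
eval-1-cleared e₁ e₂ e₃ d δ f refl refl refl = identity e₁ e₂ e₃ d δ f
  where
  identity : ∀ e₁ e₂ e₃ d δ f →
    eval (cubic (- e₁) e₂ (- e₃)) 1ℚ * (d * (δ * f))
      ≡ d * (δ * f) - e₁ * d * (δ * f) + e₂ * f * (d * δ) - e₃ * (δ * f) * d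
  identity = solve 6 (λ e₁ e₂ e₃ d δ f →
    (con 1ℚ :^ 3 :+ :- e₁ :* con 1ℚ :^ 2 :+ e₂ :* con 1ℚ :+ :- e₃) :* (d :* (δ :* f))
      := d :* (δ :* f) :- e₁ :* d :* (δ :* f) :+ e₂ :* f :* (d :* δ) :- e₃ :* (δ :* f) :* d) refl

K : ∀ {n} → ℕ → Polynomial n
K m = con (k m)

-- Solver syntax for the quantities of Defs: ⟦ X′ ⟧₂ b c is definitionally X b c, and
-- N0i b c is literally the numerator of E0i b c.
module _ {n : ℕ} (b c : Polynomial n) where
  Δ′ F₁′ F₂′ D′ F²′ curve′ N01′ N02′ N03′ : Polynomial n
  Δ′ = K 1 :* b :^ 2 :* c :^ 4 :- K 6 :* b :^ 2 :* c :^ 3 :+ K 13 :* b :^ 2 :* c :^ 2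
       :- K 12 :* b :^ 2 :* c :+ K 4 :* b :^ 2 :+ c :^ 2
  F₁′ = b :* c :- K 1 :- b
  F₂′ = b :* c :- c :- K 2 :* b
  D′ = b :^ 2 :* c :^ 2 :+ K 2 :* b :^ 2 :- K 3 :* b :^ 2 :* c :+ c :- b :* c :^ 2 :+ K 2 :* b
  F²′ = F₁′ :^ 2 :* F₂′ :^ 2
  curve′ = K 2 :* b :* c :^ 2 :- K 4 :* b :* c :+ K 2 :* b :- c :^ 2
  N01′ = :- (b :* (c :^ 2 :+ K 2 :- K 2 :* c))
  N02′ = con (+ 1 / 2) :* (K 28 :* b :^ 2 :* c :^ 2 :- K 16 :* b :^ 2 :* c :- K 2 :* c :^ 2
         :- K 4 :* b :^ 2 :- b :^ 2 :* c :^ 4 :+ K 4 :* b :^ 3 :* c :^ 4 :- K 12 :* b :^ 3 :* c :^ 3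
         :+ K 4 :* b :* c :^ 3 :+ K 24 :* b :^ 3 :* c :- K 8 :* b :* c :- K 2 :* b :^ 4 :* c :^ 4
         :+ K 12 :* b :^ 4 :* c :^ 3 :- K 26 :* b :^ 4 :* c :^ 2 :- K 8 :* b :^ 2 :* c :^ 3
         :+ K 24 :* b :^ 4 :* c :- K 16 :* b :^ 3 :- K 8 :* b :^ 4)
  N03′ = con (+ 1 / 2) :* b
         :* (b :^ 2 :* c :^ 4 :- K 5 :* b :^ 2 :* c :^ 3 :+ K 10 :* b :^ 2 :* c :^ 2
             :- K 10 :* b :^ 2 :* c :+ K 4 :* b :^ 2 :+ K 2 :* b :* c :+ K 2 :* c :^ 2 :- b :* c :^ 3)
         :* (K 2 :* b :^ 2 :* c :^ 4 :- K 12 :* b :^ 2 :* c :^ 3 :+ K 26 :* b :^ 2 :* c :^ 2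
             :- K 24 :* b :^ 2 :* c :+ K 8 :* b :^ 2 :- c :^ 4 :* b :+ K 3 :* b :* c :^ 3
             :- K 6 :* b :* c :+ K 4 :* b :+ c :^ 3 :- K 2 :* c :^ 2 :+ K 2 :* c)

⟦_⟧₂ : (Polynomial 2 → Polynomial 2 → Polynomial 2) → ℚ → ℚ → ℚ
⟦ p ⟧₂ b c = ⟦ p (var zero) (var (suc zero)) ⟧ (b ∷ c ∷ [])

curve N01 N02 N03 : ℚ → ℚ → ℚ
curve = ⟦ curve′ ⟧₂
N01 = ⟦ N01′ ⟧₂
N02 = ⟦ N02′ ⟧₂
N03 = ⟦ N03′ ⟧₂

D≡F₁*F₂ : ∀ b c → D b c ≡ F₁ b c * F₂ b c
D≡F₁*F₂ = solve 2 (λ b c → D′ b c := F₁′ b c :* F₂′ b c) refl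

F²≡[F₁*F₂]² : ∀ b c → F² b c ≡ (F₁ b c * F₂ b c) * (F₁ b c * F₂ b c)
F²≡[F₁*F₂]² = solve 2 (λ b c → F²′ b c := (F₁′ b c :* F₂′ b c) :* (F₁′ b c :* F₂′ b c)) refl

Q-1-numerator : ∀ b c →
  D b c * (Δ b c * F² b c) - N01 b c * (Δ b c * F² b c) + N02 b c * (D b c * Δ b c) - N03 b c * D b c
    ≡ D b c * (b * (c - k 2) * curve b c) ^ 2
Q-1-numerator = solve 2 (λ b c →
  D′ b c :* (Δ′ b c :* F²′ b c) :- N01′ b c :* (Δ′ b c :* F²′ b c)
    :+ N02′ b c :* (D′ b c :* Δ′ b c) :- N03′ b c :* D′ b c
  := D′ b c :* (b :* (c :- K 2) :* curve′ b c) :^ 2) refl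

eval-Q-1-cleared : ∀ b c → D b c ≢ 0ℚ → F² b c ≢ 0ℚ → Δ b c * F² b c ≢ 0ℚ →
  eval (Q b c) 1ℚ * (D b c * (Δ b c * F² b c)) ≡ D b c * (b * (c - k 2) * curve b c) ^ 2
eval-Q-1-cleared b c D≢0 F²≢0 ΔF²≢0 =
  trans (eval-1-cleared (E01 b c) (E02 b c) (E03 b c) (D b c) (Δ b c) (F² b c)
           (x⊘y*y≡x (N01 b c) D≢0) (x⊘y*y≡x (N02 b c) F²≢0) (x⊘y*y≡x (N03 b c) ΔF²≢0))
        (Q-1-numerator b c)

eval-Q-1-on-curve : ∀ b c → Δ b c * (F₁ b c * F₂ b c) ≢ 0ℚ → curve b c ≡ 0ℚ →
  eval (Q b c) 1ℚ ≡ 0ℚ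
eval-Q-1-on-curve b c nondegenerate on-curve = x*y≡0⇒x≡0 DΔF²≢0 (begin
  eval (Q b c) 1ℚ * (D b c * (Δ b c * F² b c))  ≡⟨ eval-Q-1-cleared b c D≢0 F²≢0 ΔF²≢0 ⟩
  D b c * (b * (c - k 2) * curve b c) ^ 2        ≡⟨ cong (λ t → D b c * (b * (c - k 2) * t) ^ 2) on-curve ⟩
  D b c * (b * (c - k 2) * 0ℚ) ^ 2               ≡⟨ vanishes (D b c) b c ⟩
  0ℚ                                             ∎)
  where
  open ≡-Reasoning
  F₁F₂≢0 : F₁ b c * F₂ b c ≢ 0ℚ
  F₁F₂≢0 = x*y≢0⇒y≢0 (Δ b c) (F₁ b c * F₂ b c) nondegenerate
  D≢0 : D b c ≢ 0ℚ
  D≢0 D≡0 = F₁F₂≢0 (trans (sym (D≡F₁*F₂ b c)) D≡0)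
  F²≢0 : F² b c ≢ 0ℚ
  F²≢0 F²≡0 = x*y≢0 F₁F₂≢0 F₁F₂≢0 (trans (sym (F²≡[F₁*F₂]² b c)) F²≡0)
  ΔF²≢0 : Δ b c * F² b c ≢ 0ℚ
  ΔF²≢0 = x*y≢0 (x*y≢0⇒x≢0 (Δ b c) (F₁ b c * F₂ b c) nondegenerate) F²≢0
  DΔF²≢0 : D b c * (Δ b c * F² b c) ≢ 0ℚ
  DΔF²≢0 = x*y≢0 D≢0 ΔF²≢0
  vanishes : ∀ d b c → d * (b * (c - k 2) * 0ℚ) ^ 2 ≡ 0ℚ
  vanishes = solve 3 (λ d b c → d :* (b :* (c :- K 2) :* con 0ℚ) :^ 2 := con 0ℚ) refl

E30-on-curve : ∀ b c → curve b c ≡ 0ℚ → E30 b c ≡ 0ℚ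
E30-on-curve b c on-curve = x*z⊘y≡0 cofactor (Δ b c * F² b c) (trans (reorder b c) on-curve)
  where
  cofactor : ℚ
  cofactor = c * b ^ 2 * (k 1 - c) * (c - k 2) * (b * c ^ 2 - k 4 * b * c + k 2 + k 4 * b)
  reorder : ∀ b c → k 2 * b * c ^ 2 - c ^ 2 - k 4 * b * c + k 2 * b ≡ curve b c
  reorder = solve 2 (λ b c → K 2 :* b :* c :^ 2 :- c :^ 2 :- K 4 :* b :* c :+ K 2 :* b := curve′ b c) refl

eval-P-0-on-curve : ∀ b c → curve b c ≡ 0ℚ → eval (P b c) 0ℚ ≡ 0ℚ
eval-P-0-on-curve b c on-curve =
  trans (eval-0 (- E10 b c) (E20 b c) (- E30 b c)) (cong -_ (E30-on-curve b c on-curve))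

theorem6p2 : (b c : ℚ) →
    Δ b c * (F₁ b c * F₂ b c) ≢ 0ℚ →
    k 2 * b * c ^ 2 - k 4 * b * c + k 2 * b - c ^ 2 ≡ 0ℚ →
    (Reducible (P b c) × Reducible (Q b c)) ×
    (eval (P b c) 0ℚ ≡ 0ℚ × eval (Q b c) 1ℚ ≡ 0ℚ)
theorem6p2 b c nondegenerate on-curve =
  (root⇒reducible (P b c) 0ℚ P[0]≡0 , root⇒reducible (Q b c) 1ℚ Q[1]≡0) , P[0]≡0 , Q[1]≡0
  where
  P[0]≡0 : eval (P b c) 0ℚ ≡ 0ℚ
  P[0]≡0 = eval-P-0-on-curve b c on-curve
  Q[1]≡0 : eval (Q b c) 1ℚ ≡ 0ℚ
  Q[1]≡0 = eval-Q-1-on-curve b c nondegenerate on-curve
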